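{- Let $\mathcal{C}(\mathsf{K}_{\mathsf{At}})=\langle(\mathsf{K}_\Phi)_{\Phi\subseteq\mathsf{At}},(f^\Phi_\Psi)_{\Psi\subseteq\Phi\subseteq\mathsf{At}}\rangle$ be a category of FH models with top model $\mathsf{K}_{\mathsf{At}}$, and let $HMS(\mathsf{K}_{\mathsf{At}})$ be the HMS-transform of $\mathsf{K}_{\mathsf{At}}$ (formed from this category). Then for all $w\in W_{\mathsf{At}}$, all $\varphi\in\mathcal{L}_{\mathsf{At}}$, and all $\Phi\subseteq\mathsf{At}$ with $\mathsf{At}(\varphi)\subseteq\Phi$: $\mathsf{K}_{\mathsf{At}},w\Vdash\varphi$ if and only if $HMS(\mathsf{K}_{\mathsf{At}}),w_\Phi\vDash\varphi$, where $w_\Phi:=f^{\mathsf{At}}_\Phi(w)$.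
   Context: Fix non-empty sets $\mathsf{At}$ (atoms) and $I$ (individuals). Language $\mathcal{L}_{\mathsf{At}}$: $\varphi::=\top\mid p\mid\neg\varphi\mid\varphi\wedge\psi\mid\ell_i\varphi\mid a_i\varphi\mid k_i\varphi$; $\mathsf{At}(\varphi)$ = atoms occurring in $\varphi$; $\mathcal{L}_\Phi=\{\varphi:\mathsf{At}(\varphi)\subseteq\Phi\}$; for a set of formulas $A$, $\mathsf{At}(A)=\bigcup_{\varphi\in A}\mathsf{At}(\varphi)$. FH model for $\Phi\subseteq\mathsf{At}$: $\mathsf{K}_\Phi=\langle I,W_\Phi,(R_{\Phi,i}),(\mathcal{A}_{\Phi,i}),V_\Phi\rangle$, $W_\Phi\ne\emptyset$, $R_{\Phi,i}$ equivalence relations on $W_\Phi$, $\mathcal{A}_{\Phi,i}:W_\Phi\to2^{\mathcal{L}_\Phi}$ with $\varphi\in\mathcal{A}_{\Phi,i}(w)$ iff all $p\in\mathsf{At}(\varphi)$ lie in $\mathcal{A}_{\Phi,i}(w)$, and $(w,t)\in R_{\Phi,i}\Rightarrow\mathcal{A}_{\Phi,i}(w)=\mathcal{A}_{\Phi,i}(t)$; $V_\Phi:\Phi\to2^{W_\Phi}$. Satisfaction ($\varphi\in\mathcal{L}_\Phi$): $\top$ always; $p$ iff $w\in V_\Phi(p)$; Boolean clauses usual; $a_i\varphi$ iff $\varphi\in\mathcal{A}_{\Phi,i}(w)$; $\ell_i\varphi$ iff $\varphi$ holds at all $t$ with $(w,t)\in R_{\Phi,i}$; $k_i\varphi$ abbreviates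 $\ell_i\varphi\wedge a_i\varphi$. Surjective bounded morphism $f^\Phi_\Psi$ ($\Psi\subseteq\Phi$): a surjection $W_\Phi\to W_\Psi$ with: $w\in V_\Phi(p)\iff f^\Phi_\Psi(w)\in V_\Psi(p)$ for $p\in\Psi$; $\mathcal{A}_{\Phi,i}(w)\cap\mathcal{L}_\Psi=\mathcal{A}_{\Psi,i}(f^\Phi_\Psi(w))$; $(w,t)\in R_{\Phi,i}\Rightarrow(f^\Phi_\Psi(w),f^\Phi_\Psi(t))\in R_{\Psi,i}$; if $(f^\Phi_\Psi(w),t')\in R_{\Psi,i}$ then some $t$ has $f^\Phi_\Psi(t)=t'$ and $(w,t)\in R_{\Phi,i}$. A category of FH models has one FH model $\mathsf{K}_\Phi$ for each $\Phi\subseteq\mathsf{At}$ and surjective bounded morphisms $f^\Phi_\Psi$ for all $\Psi\subseteq\Phi$, with $f^\Phi_\Phi=\mathrm{id}$ and $f^\Phi_\Upsilon=f^\Psi_\Upsilon\circ f^\Phi_\Psi$. HMS-transform. Step 1 ($T$-transform): $S_\Phi:=W_\Phi$, $\Omega:=\bigcup_\Phi S_\Phi$, $r^\Phi_\Psi:=f^\Phi_\Psi$; for $w\in S_\Phi$, $\Lambda_i(w):=\{w':(w,w')\in R_{\Phi,i}\}$; for $w\in S_\Psi$, $\alpha_i(w):=S_\Upsilon$ where $\Upsilon=\mathsf{At}(\mathcal{A}_{\Psi,i}(w))$; $v(p):=\bigcup_{\Phi\ni p}V_\Phi(p)$. Notation: for $\omega\in S_\Phi$, $\Psi\subseteq\Phi$,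 $\omega_\Psi=r^\Phi_\Psi(\omega)$, $D_\Psi=D_{S_\Psi}=r^\Phi_\Psi(D)$; spaces ordered by $S_{\Phi'}\succeq S_\Phi$ iff $\Phi\subseteq\Phi'$; $D^\uparrow=\bigcup_{\Phi\subseteq\Psi}(r^\Psi_\Phi)^{ -1}(D)$ for $D\subseteq S_\Phi$; events are sets $D^\uparrow$ with base-space $S(D^\uparrow)=S_\Phi$ (vacuous events $\emptyset^{S_\Phi}$ distinguished by base-space); $\neg D^\uparrow=(S_\Phi\setminus D)^\uparrow$. Step 2: derive $\Pi_i(\omega_\Phi):=\Lambda_i(\omega)_{\alpha_i(\omega_\Phi)}$ for all $\omega\in\Omega$ and $\Phi$ with $\omega_\Phi$ defined; $S_{\Pi_i(\omega)}$ denotes the space containing $\Pi_i(\omega)$. Step 3: discard the $\alpha_i$; $HMS(\mathsf{K}_{\mathsf{At}})=\langle I,\{S_\Phi\},(r^\Phi_\Psi),(\Lambda_i),(\Pi_i),v\rangle$. Satisfaction in such a (complemented HMS) model at $\omega\in\Omega$: $\top$ always; $p$ iff $\omega\in v(p)$; $\neg\varphi$ iff $\omega\in\neg[\varphi]$; $\varphi\wedge\psi$ iff $\omega\in[\varphi]\cap[\psi]$; $a_i\varphi$ iff $S_{\Pi_i(\omega)}\succeq S([\varphi])$; $\ell_i\varphi$ iff $\Lambda_i(\omega)\subseteq[\varphi]$; $k_i\varphi$ iff $\Pi_i(\omega)\subseteq[\varphi]$; here $[\varphi]$ is the set of states satisfying $\varphi$. -}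

module Defs where

open import Data.Unit using (⊤; tt)
open import Data.Empty using (⊥)
open import Data.Product using (Σ; ∃; _×_; _,_)
open import Data.Sum using (_⊎_)
open import Relation.Nullary using (¬_)
open import Relation.Binary.PropositionalEquality using (_≡_)
open import Relation.Binary.Structures using (IsEquivalence)
open import Function.Bundles using (_⇔_)
open import Function.Bundles using (module Equivalence)

data Fm (At I : Set) : Set where
  ⊤'   : Fm At I
  var  : At → Fm At I
  ¬'_  : Fm At I → Fm At I
  _∧'_ : Fm At I → Fm At I → Fm At I
  ℓ'   : I → Fm At I → Fm At I
  a'   : I → Fm At I → Fm At I
  k'   : I → Fm At I → Fm At I

_∈At_ : {At I : Set} → At → Fm At I → Set
p ∈At ⊤' = ⊥
p ∈At var q = p ≡ q
p ∈At (¬' φ) = p ∈At φ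
p ∈At (φ ∧' ψ) = p ∈At φ ⊎ p ∈At ψ
p ∈At ℓ' i φ = p ∈At φ
p ∈At a' i φ = p ∈At φ
p ∈At k' i φ = p ∈At φ

Sub : Set → Set₁
Sub At = At → Set

_⊆_ : {At : Set} → Sub At → Sub At → Set
Ψ ⊆ Φ = ∀ p → Ψ p → Φ p

Atoms : {At I : Set} → Fm At I → Sub At
Atoms φ p = p ∈At φ

Full : (At : Set) → Sub At
Full At _ = ⊤

Full-⊇ : {At : Set} (Φ : Sub At) → Φ ⊆ Full At
Full-⊇ Φ _ _ = tt

record FHCategory (At I : Set) : Set₁ where
  field
    W        : Sub At → Set
    W-inhab  : ∀ Φ → W Φ
    R        : ∀ Φ → I → W Φ → W Φ → Set
    R-equiv  : ∀ Φ i → IsEquivalence (R Φ i)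
    A        : ∀ Φ → I → W Φ → Fm At I → Set
    A-lang   : ∀ Φ i w φ → A Φ i w φ → Atoms φ ⊆ Φ
    A-atoms  : ∀ Φ i w φ → A Φ i w φ ⇔ (∀ p → p ∈At φ → A Φ i w (var p))
    A-R      : ∀ Φ i w t → R Φ i w t → ∀ φ → A Φ i w φ ⇔ A Φ i t φ
    -- valuation V_Φ (only its values on atoms p ∈ Φ are ever used)
    V        : ∀ Φ → At → W Φ → Set
    f        : ∀ Φ Ψ → Ψ ⊆ Φ → W Φ → W Ψ
    f-surj   : ∀ Φ Ψ h (y : W Ψ) → ∃ λ x → f Φ Ψ h x ≡ y
    f-V      : ∀ Φ Ψ h p → Ψ p → ∀ w → V Φ p w ⇔ V Ψ p (f Φ Ψ h w)
    f-A      : ∀ Φ Ψ h i w φ → (A Φ i w φ × Atoms φ ⊆ Ψ) ⇔ A Ψ i (f Φ Ψ h w) φ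
    f-forth  : ∀ Φ Ψ h i w t → R Φ i w t → R Ψ i (f Φ Ψ h w) (f Φ Ψ h t)
    f-back   : ∀ Φ Ψ h i w t' → R Ψ i (f Φ Ψ h w) t' →
               ∃ λ t → f Φ Ψ h t ≡ t' × R Φ i w t
    f-id     : ∀ Φ h w → f Φ Φ h w ≡ w
    f-comp   : ∀ Φ Ψ Υ (h₁ : Ψ ⊆ Φ) (h₂ : Υ ⊆ Ψ) (h₃ : Υ ⊆ Φ) w →
               f Φ Υ h₃ w ≡ f Ψ Υ h₂ (f Φ Ψ h₁ w)

module _ {At I : Set} (C : FHCategory At I) where
  open FHCategory C

  -- Satisfaction in the FH model K_Φ (k_i φ abbreviates ℓ_i φ ∧ a_i φ).
  FHsat : ∀ Φ → W Φ → Fm At I → Set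
  FHsat Φ w ⊤' = ⊤
  FHsat Φ w (var p) = V Φ p w
  FHsat Φ w (¬' φ) = ¬ FHsat Φ w φ
  FHsat Φ w (φ ∧' ψ) = FHsat Φ w φ × FHsat Φ w ψ
  FHsat Φ w (ℓ' i φ) = ∀ t → R Φ i w t → FHsat Φ t φ
  FHsat Φ w (a' i φ) = A Φ i w φ
  FHsat Φ w (k' i φ) = (∀ t → R Φ i w t → FHsat Φ t φ) × A Φ i w φ

  -- HMS-transform.  States: Ω = ⋃_Φ S_Φ (disjoint), S_Φ = W_Φ.
  Ω : Set₁
  Ω = Σ (Sub At) W

  -- Υ = At(A_{Φ,i}(w)), so α_i(w) = S_Υ
  AwAt : ∀ Φ → I → W Φ → Sub At
  AwAt Φ i w p = Σ (Fm At I) λ φ → A Φ i w φ × p ∈At φ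

  AwAt⊆ : ∀ Φ i w → AwAt Φ i w ⊆ Φ
  AwAt⊆ Φ i w p (φ , aw , p∈) = A-lang Φ i w φ aw p p∈

  -- Π_i(w) = Λ_i(w)_{α_i(w)} = { f^Φ_Υ(t) : (w,t) ∈ R_{Φ,i} } ⊆ S_Υ
  -- Satisfaction in HMS(K_At); the base space of [φ] is S_{At(φ)}.
  HMSsat : Fm At I → Ω → Set
  HMSsat ⊤' _ = ⊤
  HMSsat (var p) (Φ , w) = Φ p × V Φ p w
  HMSsat (¬' φ) (Φ , w) =
    Σ (Atoms φ ⊆ Φ) λ h → ¬ HMSsat φ (Atoms φ , f Φ (Atoms φ) h w)
  HMSsat (φ ∧' ψ) ω = HMSsat φ ω × HMSsat ψ ω
  HMSsat (a' i φ) (Φ , w) = Atoms φ ⊆ AwAt Φ i w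
  HMSsat (ℓ' i φ) (Φ , w) = ∀ t → R Φ i w t → HMSsat φ (Φ , t)
  HMSsat (k' i φ) (Φ , w) =
    ∀ t → R Φ i w t → HMSsat φ (AwAt Φ i w , f Φ (AwAt Φ i w) (AwAt⊆ Φ i w) t)

-- First, a surjective bounded morphism f^Φ_Ψ preserves
-- and reflects the truth of every formula of L_Ψ, so FH truth of φ may be
-- evaluated in any K_Ψ with At(φ) ⊆ Ψ.  Second, on a single K_Φ the FH and
-- HMS satisfaction relations agree on L_Φ, by induction on φ: the HMS clauses
-- for ¬φ and k_i φ evaluate φ in the lower spaces S_{At(φ)} and
-- S_{At(A_i(w))}, and the first fact brings them back to K_Φ.  Awareness is
-- generated by atoms, so a_i φ holds iff At(φ) ⊆ At(A_i(w)); for k_i φ this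
-- inclusion is recovered from Π_i(w) being non-empty, since HMS truth at a
-- state of S_Ψ forces At(φ) ⊆ Ψ.
module Submission where

open import Defs
open import Function.Bundles using (_⇔_; mk⇔; Equivalence)
open import Function.Related.TypeIsomorphisms using (¬-cong-⇔)
open import Data.Product using (_,_; proj₁; proj₂)
open import Data.Product.Function.NonDependent.Propositional using (_×-⇔_)
open import Data.Sum using (inj₁; inj₂)
open import Data.Unit using (tt)
open import Relation.Binary.PropositionalEquality using (refl)
open import Relation.Binary.Structures using (IsEquivalence)
import Function.Properties.Equivalence as ⇔

open Equivalence

inhabited-⇔ : ∀ {A B : Set} → A → B → A ⇔ B
inhabited-⇔ a b = mk⇔ (λ _ → b) (λ _ → a)

module _ {At I : Set} where

  Atoms-∧ˡ : ∀ (φ ψ : Fm At I) {Φ} → Atoms (φ ∧' ψ) ⊆ Φ → Atoms φ ⊆ Φ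
  Atoms-∧ˡ φ ψ φψ⊆Φ p p∈φ = φψ⊆Φ p (inj₁ p∈φ)

  Atoms-∧ʳ : ∀ (φ ψ : Fm At I) {Φ} → Atoms (φ ∧' ψ) ⊆ Φ → Atoms ψ ⊆ Φ
  Atoms-∧ʳ φ ψ φψ⊆Φ p p∈ψ = φψ⊆Φ p (inj₂ p∈ψ)

module _ {At I : Set} (C : FHCategory At I) where
  open FHCategory C

  R-refl : ∀ Φ i w → R Φ i w w
  R-refl Φ i w = IsEquivalence.refl (R-equiv Φ i)

  ℓ-transfer : ∀ φ {Φ Ψ} (h : Ψ ⊆ Φ) i w →
               (∀ t → FHsat C Φ t φ ⇔ FHsat C Ψ (f Φ Ψ h t) φ) →
               FHsat C Φ w (ℓ' i φ) ⇔ FHsat C Ψ (f Φ Ψ h w) (ℓ' i φ)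
  ℓ-transfer φ {Φ} {Ψ} h i w φ-transfer = mk⇔ forth back
    where
    forth : FHsat C Φ w (ℓ' i φ) → FHsat C Ψ (f Φ Ψ h w) (ℓ' i φ)
    forth □φ t' wRt' with f-back Φ Ψ h i w t' wRt'
    ... | t , refl , wRt = to (φ-transfer t) (□φ t wRt)

    back : FHsat C Ψ (f Φ Ψ h w) (ℓ' i φ) → FHsat C Φ w (ℓ' i φ)
    back □φ t wRt = from (φ-transfer t) (□φ (f Φ Ψ h t) (f-forth Φ Ψ h i w t wRt))

  a-transfer : ∀ φ {Φ Ψ} (h : Ψ ⊆ Φ) i w → Atoms φ ⊆ Ψ →
               A Φ i w φ ⇔ A Ψ i (f Φ Ψ h w) φ
  a-transfer φ {Φ} {Ψ} h i w φ⊆Ψ =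
    mk⇔ (λ aw → to (f-A Φ Ψ h i w φ) (aw , φ⊆Ψ))
        (λ aw → proj₁ (from (f-A Φ Ψ h i w φ) aw))

  FHsat-transfer : ∀ φ {Φ Ψ} (h : Ψ ⊆ Φ) w → Atoms φ ⊆ Ψ →
                   FHsat C Φ w φ ⇔ FHsat C Ψ (f Φ Ψ h w) φ
  FHsat-transfer ⊤'       h w φ⊆Ψ = inhabited-⇔ tt tt
  FHsat-transfer (var p)  {Φ} {Ψ} h w φ⊆Ψ = f-V Φ Ψ h p (φ⊆Ψ p refl) w
  FHsat-transfer (¬' φ)   h w φ⊆Ψ = ¬-cong-⇔ (FHsat-transfer φ h w φ⊆Ψ)
  FHsat-transfer (φ ∧' ψ) h w φ⊆Ψ =
    FHsat-transfer φ h w (Atoms-∧ˡ φ ψ φ⊆Ψ) ×-⇔ FHsat-transfer ψ h w (Atoms-∧ʳ φ ψ φ⊆Ψ)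
  FHsat-transfer (ℓ' i φ) h w φ⊆Ψ =
    ℓ-transfer φ h i w (λ t → FHsat-transfer φ h t φ⊆Ψ)
  FHsat-transfer (a' i φ) h w φ⊆Ψ = a-transfer φ h i w φ⊆Ψ
  FHsat-transfer (k' i φ) h w φ⊆Ψ =
    ℓ-transfer φ h i w (λ t → FHsat-transfer φ h t φ⊆Ψ) ×-⇔ a-transfer φ h i w φ⊆Ψ

  HMSsat⇒Atoms⊆ : ∀ φ Ψ w → HMSsat C φ (Ψ , w) → Atoms φ ⊆ Ψ
  HMSsat⇒Atoms⊆ ⊤'       Ψ w _ p ()
  HMSsat⇒Atoms⊆ (var q)  Ψ w (q∈Ψ , _) p refl = q∈Ψ
  HMSsat⇒Atoms⊆ (¬' φ)   Ψ w (φ⊆Ψ , _) = φ⊆Ψ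
  HMSsat⇒Atoms⊆ (φ ∧' ψ) Ψ w (φ-sat , _) p (inj₁ p∈φ) = HMSsat⇒Atoms⊆ φ Ψ w φ-sat p p∈φ
  HMSsat⇒Atoms⊆ (φ ∧' ψ) Ψ w (_ , ψ-sat) p (inj₂ p∈ψ) = HMSsat⇒Atoms⊆ ψ Ψ w ψ-sat p p∈ψ
  HMSsat⇒Atoms⊆ (ℓ' i φ) Ψ w □φ = HMSsat⇒Atoms⊆ φ Ψ w (□φ w (R-refl Ψ i w))
  HMSsat⇒Atoms⊆ (a' i φ) Ψ w φ⊆Aw p p∈φ = AwAt⊆ C Ψ i w p (φ⊆Aw p p∈φ)
  HMSsat⇒Atoms⊆ (k' i φ) Ψ w □φ p p∈φ =
    AwAt⊆ C Ψ i w p (HMSsat⇒Atoms⊆ φ (AwAt C Ψ i w) _ (□φ w (R-refl Ψ i w)) p p∈φ)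

  A⇔Atoms⊆AwAt : ∀ Φ i w φ → A Φ i w φ ⇔ Atoms φ ⊆ AwAt C Φ i w
  A⇔Atoms⊆AwAt Φ i w φ = mk⇔ (λ aw p p∈φ → φ , aw , p∈φ) aware
    where
    aware : Atoms φ ⊆ AwAt C Φ i w → A Φ i w φ
    aware φ⊆Aw = from (A-atoms Φ i w φ) λ p p∈φ →
      let (ψ , awψ , p∈ψ) = φ⊆Aw p p∈φ in to (A-atoms Φ i w ψ) awψ p p∈ψ

  mutual
    FHsat⇔HMSsat : ∀ φ Φ w → Atoms φ ⊆ Φ → FHsat C Φ w φ ⇔ HMSsat C φ (Φ , w)
    FHsat⇔HMSsat ⊤'       Φ w φ⊆Φ = inhabited-⇔ tt tt
    FHsat⇔HMSsat (var p)  Φ w φ⊆Φ = mk⇔ (φ⊆Φ p refl ,_) proj₂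
    FHsat⇔HMSsat (¬' φ)   Φ w φ⊆Φ = mk⇔
      (λ ¬φ → φ⊆Φ , λ φ-sat → ¬φ (from (FHsat⇔HMSsat-image φ φ⊆Φ w λ _ p∈φ → p∈φ) φ-sat))
      (λ (h , ¬φ) φ-sat → ¬φ (to (FHsat⇔HMSsat-image φ h w λ _ p∈φ → p∈φ) φ-sat))
    FHsat⇔HMSsat (φ ∧' ψ) Φ w φ⊆Φ =
      FHsat⇔HMSsat φ Φ w (Atoms-∧ˡ φ ψ φ⊆Φ) ×-⇔ FHsat⇔HMSsat ψ Φ w (Atoms-∧ʳ φ ψ φ⊆Φ)
    FHsat⇔HMSsat (ℓ' i φ) Φ w φ⊆Φ =
      mk⇔ (λ □φ t wRt → to (FHsat⇔HMSsat φ Φ t φ⊆Φ) (□φ t wRt))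
          (λ □φ t wRt → from (FHsat⇔HMSsat φ Φ t φ⊆Φ) (□φ t wRt))
    FHsat⇔HMSsat (a' i φ) Φ w φ⊆Φ = A⇔Atoms⊆AwAt Φ i w φ
    FHsat⇔HMSsat (k' i φ) Φ w φ⊆Φ = mk⇔ forth back
      where
      Aw = AwAt C Φ i w
      image : Atoms φ ⊆ Aw →
              ∀ t → FHsat C Φ t φ ⇔ HMSsat C φ (Aw , f Φ Aw (AwAt⊆ C Φ i w) t)
      image φ⊆Aw t = FHsat⇔HMSsat-image φ (AwAt⊆ C Φ i w) t φ⊆Aw

      forth : FHsat C Φ w (k' i φ) → HMSsat C (k' i φ) (Φ , w)
      forth (□φ , aw) t wRt = to (image (to (A⇔Atoms⊆AwAt Φ i w φ) aw) t) (□φ t wRt)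

      back : HMSsat C (k' i φ) (Φ , w) → FHsat C Φ w (k' i φ)
      back □φ = (λ t wRt → from (image φ⊆Aw t) (□φ t wRt))
              , from (A⇔Atoms⊆AwAt Φ i w φ) φ⊆Aw
        where
        φ⊆Aw : Atoms φ ⊆ Aw
        φ⊆Aw = HMSsat⇒Atoms⊆ φ Aw _ (□φ w (R-refl Φ i w))

    FHsat⇔HMSsat-image : ∀ φ {Φ Ψ} (h : Ψ ⊆ Φ) w → Atoms φ ⊆ Ψ →
                         FHsat C Φ w φ ⇔ HMSsat C φ (Ψ , f Φ Ψ h w)
    FHsat⇔HMSsat-image φ {Ψ = Ψ} h w φ⊆Ψ =
      ⇔.trans (FHsat-transfer φ h w φ⊆Ψ) (FHsat⇔HMSsat φ Ψ _ φ⊆Ψ)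

proposition10 : {At I : Set} → At → I → (C : FHCategory At I) →
    (w : FHCategory.W C (Full At)) (φ : Fm At I) (Φ : Sub At) → Atoms φ ⊆ Φ →
    FHsat C (Full At) w φ ⇔
    HMSsat C φ (Φ , FHCategory.f C (Full At) Φ (Full-⊇ Φ) w)
proposition10 _ _ C w φ Φ φ⊆Φ = FHsat⇔HMSsat-image C φ (Full-⊇ Φ) w φ⊆Φ
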